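{- Let $D=(V,A)$ be a digraph. Then $$EI(N\mathcal H(D))\cup \mathcal H'(D)=DC\mathcal H(D)\cup EI(C\mathcal H(D))\cup EI(CE\mathcal H(D)),$$ where the union of hypergraphs on the common vertex set $V$ is the hypergraph on $V$ whose edge set is the union of their edge sets.
   Context: For $v\in V$, $N_D^-(v)=\{u\in V:(u,v)\in A\}$ and $N_D^+(v)=\{u\in V:(v,u)\in A\}$. All hypergraphs below have vertex set $V$ and edge sets consisting of subsets $e\subseteq V$ with $|e|\ge 2$: competition hypergraph $C\mathcal H(D)$: $\mathcal E^C=\{e: |e|\ge2,\ \exists v\in V,\ e=N_D^-(v)\}$; common enemy hypergraph $CE\mathcal H(D)$: $\mathcal E^{CE}=\{e: |e|\ge2,\ \exists v\in V,\ e=N_D^+(v)\}$; double competition hypergraph $DC\mathcal H(D)$: $\mathcal E^{DC}=\{e: |e|\ge2,\ \exists v_1,v_2\in V,\ e=N_D^+(v_1)\cap N_D^-(v_2)\}$; niche hypergraph $N\mathcal H(D)$: $\mathcal E^N=\{e: |e|\ge2,\ \exists v\in V,\ e=N_D^-(v)\ \text{or}\ e=N_D^+(v)\}$; $\mathcal H'(D)$: edge set $\{e: |e|\ge2,\ \exists v_1,v_2\in V,\ e=N_D^-(v_1)=N_D^+(v_2)\}$. For a hypergraph $\mathcal H=(V,\mathcal E)$, its edge intersection hypergraph is $EI(\mathcal H)=(V,\mathcal E^{EI})$ with $\mathcal E^{EI}=\{e_1\cap e_2 \mid e_1,e_2\in\mathcal E,\ e_1\neq e_2,\ |e_1\cap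 e_2|\ge 2\}$. -}

module Defs where

open import Data.Nat using (ℕ; _≤_)
open import Data.Bool using (Bool)
open import Data.Fin using (Fin)
open import Data.Fin.Subset using (Subset; _∩_; ∣_∣)
open import Data.Vec using (tabulate)
open import Data.Product using (_×_; ∃; ∃-syntax)
open import Data.Sum using (_⊎_)
open import Relation.Binary.PropositionalEquality using (_≡_; _≢_)

-- A finite digraph D = (V, A) with V = Fin n; the arc set A is given by
-- its (Boolean) adjacency relation: A u v = true iff (u , v) ∈ A.
Digraph : ℕ → Set
Digraph n = Fin n → Fin n → Bool

inNbr : ∀ {n} → Digraph n → Fin n → Subset n
inNbr D v = tabulate (λ u → D u v)

outNbr : ∀ {n} → Digraph n → Fin n → Subset n
outNbr D v = tabulate (λ u → D v u)

-- A hypergraph on vertex set Fin n is given by its edge set,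
-- a predicate on subsets of Fin n.
EdgeSet : ℕ → Set₁
EdgeSet n = Subset n → Set

CH : ∀ {n} → Digraph n → EdgeSet n
CH D e = (2 ≤ ∣ e ∣) × ∃[ v ] (e ≡ inNbr D v)

CEH : ∀ {n} → Digraph n → EdgeSet n
CEH D e = (2 ≤ ∣ e ∣) × ∃[ v ] (e ≡ outNbr D v)

DCH : ∀ {n} → Digraph n → EdgeSet n
DCH D e = (2 ≤ ∣ e ∣) × ∃[ v₁ ] ∃[ v₂ ] (e ≡ outNbr D v₁ ∩ inNbr D v₂)

NH : ∀ {n} → Digraph n → EdgeSet n
NH D e = (2 ≤ ∣ e ∣) × ∃[ v ] ((e ≡ inNbr D v) ⊎ (e ≡ outNbr D v))

H′ : ∀ {n} → Digraph n → EdgeSet n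
H′ D e = (2 ≤ ∣ e ∣) × ∃[ v₁ ] ∃[ v₂ ] ((e ≡ inNbr D v₁) × (e ≡ outNbr D v₂))

EI : ∀ {n} → EdgeSet n → EdgeSet n
EI E e = ∃[ e₁ ] ∃[ e₂ ] (E e₁ × E e₂ × (e₁ ≢ e₂) × (e ≡ e₁ ∩ e₂) × (2 ≤ ∣ e ∣))

infixr 5 _∪ₕ_
_∪ₕ_ : ∀ {n} → EdgeSet n → EdgeSet n → EdgeSet n
(E ∪ₕ F) e = E e ⊎ F e

infix 4 _≐ₕ_
_≐ₕ_ : ∀ {n} → EdgeSet n → EdgeSet n → Set
E ≐ₕ F = ∀ e → (E e → F e) × (F e → E e)

-- An edge of EI(NH(D)) is the intersection of two distinct in- or
-- out-neighbourhoods: two in-neighbourhoods give an edge of EI(CH(D)), two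
-- out-neighbourhoods one of EI(CEH(D)), and a mixed pair N⁺(v₁) ∩ N⁻(v₂) is
-- a double competition edge.  An edge N⁻(v₁) = N⁺(v₂) of H′(D) is the
-- degenerate double competition edge N⁺(v₂) ∩ N⁻(v₁).  Conversely a double
-- competition edge N⁺(v₁) ∩ N⁻(v₂) lies in EI(NH(D)) when the two
-- neighbourhoods differ and in H′(D) when they coincide.
module Submission where

open import Data.Nat using (ℕ; _≤_)
open import Data.Nat.Properties using (≤-trans)
open import Data.Bool.Properties using () renaming (_≟_ to _≟ᵇ_)
open import Data.Fin.Subset using (Subset; _∩_; ∣_∣)
open import Data.Fin.Subset.Properties using (p⊆q⇒∣p∣≤∣q∣; p∩q⊆p; p∩q⊆q; ∩-comm; ∩-idem)
open import Data.Vec.Properties using (≡-dec)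
open import Data.Product using (_,_)
open import Data.Sum using (inj₁; inj₂; [_,_])
open import Function using (_∘_)
open import Relation.Nullary using (yes; no)
open import Relation.Binary.PropositionalEquality using (_≡_; refl; sym; trans; cong; cong₂; subst; module ≡-Reasoning)
open import Defs

infix 4 _⊆ₕ_
_⊆ₕ_ : ∀ {n} → EdgeSet n → EdgeSet n → Set
E ⊆ₕ F = ∀ {e} → E e → F e

module _ {n : ℕ} where

  2≤∣p∩q∣⇒2≤∣p∣ : (p q : Subset n) → 2 ≤ ∣ p ∩ q ∣ → 2 ≤ ∣ p ∣
  2≤∣p∩q∣⇒2≤∣p∣ p q h = ≤-trans h (p⊆q⇒∣p∣≤∣q∣ (p∩q⊆p p q))

  2≤∣p∩q∣⇒2≤∣q∣ : (p q : Subset n) → 2 ≤ ∣ p ∩ q ∣ → 2 ≤ ∣ q ∣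
  2≤∣p∩q∣⇒2≤∣q∣ p q h = ≤-trans h (p⊆q⇒∣p∣≤∣q∣ (p∩q⊆q p q))

  EI-mono : {E F : EdgeSet n} → E ⊆ₕ F → EI E ⊆ₕ EI F
  EI-mono E⊆F (e₁ , e₂ , E₁ , E₂ , rest) = e₁ , e₂ , E⊆F E₁ , E⊆F E₂ , rest

module _ {n : ℕ} (D : Digraph n) where

  CH⊆NH : CH D ⊆ₕ NH D
  CH⊆NH (large , v , e≡in) = large , v , inj₁ e≡in

  CEH⊆NH : CEH D ⊆ₕ NH D
  CEH⊆NH (large , v , e≡out) = large , v , inj₂ e≡out

  NH⊆CH∪CEH : NH D ⊆ₕ CH D ∪ₕ CEH D
  NH⊆CH∪CEH (large , v , inj₁ e≡in)  = inj₁ (large , v , e≡in)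
  NH⊆CH∪CEH (large , v , inj₂ e≡out) = inj₂ (large , v , e≡out)

  H′⊆DCH : H′ D ⊆ₕ DCH D
  H′⊆DCH {e} (large , v₁ , v₂ , e≡in , e≡out) = large , v₂ , v₁ , e≡out∩in
    where
      open ≡-Reasoning
      e≡out∩in : e ≡ outNbr D v₂ ∩ inNbr D v₁
      e≡out∩in = begin
        e                       ≡⟨ sym (∩-idem e) ⟩
        e ∩ e                   ≡⟨ cong₂ _∩_ e≡out e≡in ⟩
        outNbr D v₂ ∩ inNbr D v₁ ∎

  EI-NH⊆DCH∪EI-CH∪EI-CEH : EI (NH D) ⊆ₕ DCH D ∪ₕ EI (CH D) ∪ₕ EI (CEH D)
  EI-NH⊆DCH∪EI-CH∪EI-CEH (e₁ , e₂ , N₁ , N₂ , e₁≢e₂ , e≡ , large)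
    with NH⊆CH∪CEH N₁ | NH⊆CH∪CEH N₂
  ... | inj₁ C₁ | inj₁ C₂ = inj₂ (inj₁ (e₁ , e₂ , C₁ , C₂ , e₁≢e₂ , e≡ , large))
  ... | inj₂ C₁ | inj₂ C₂ = inj₂ (inj₂ (e₁ , e₂ , C₁ , C₂ , e₁≢e₂ , e≡ , large))
  ... | inj₁ (_ , v₁ , e₁≡in) | inj₂ (_ , v₂ , e₂≡out) =
    inj₁ (large , v₂ , v₁ , trans e≡ (trans (∩-comm e₁ e₂) (cong₂ _∩_ e₂≡out e₁≡in)))
  ... | inj₂ (_ , v₁ , e₁≡out) | inj₁ (_ , v₂ , e₂≡in) =
    inj₁ (large , v₁ , v₂ , trans e≡ (cong₂ _∩_ e₁≡out e₂≡in))

  DCH⊆EI-NH∪H′ : DCH D ⊆ₕ EI (NH D) ∪ₕ H′ D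
  DCH⊆EI-NH∪H′ {e} (large , v₁ , v₂ , e≡) with ≡-dec _≟ᵇ_ (outNbr D v₁) (inNbr D v₂)
  ... | yes out≡in = inj₂ (large , v₂ , v₁ , e≡in , e≡out)
    where
      e≡in : e ≡ inNbr D v₂
      e≡in = trans e≡ (trans (cong (_∩ inNbr D v₂) out≡in) (∩-idem _))
      e≡out : e ≡ outNbr D v₁
      e≡out = trans e≡ (trans (cong (outNbr D v₁ ∩_) (sym out≡in)) (∩-idem _))
  ... | no out≢in = inj₁ (out , in′ ,
                          (2≤∣p∩q∣⇒2≤∣p∣ out in′ large∩ , v₁ , inj₂ refl) ,
                          (2≤∣p∩q∣⇒2≤∣q∣ out in′ large∩ , v₂ , inj₁ refl) ,
                          out≢in , e≡ , large)
    where
      out in′ : Subset n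
      out = outNbr D v₁
      in′ = inNbr D v₂
      large∩ : 2 ≤ ∣ out ∩ in′ ∣
      large∩ = subst (λ s → 2 ≤ ∣ s ∣) e≡ large

theorem2 : (n : ℕ) (D : Digraph n) →
    (EI (NH D) ∪ₕ H′ D) ≐ₕ (DCH D ∪ₕ EI (CH D) ∪ₕ EI (CEH D))
theorem2 n D e =
  [ EI-NH⊆DCH∪EI-CH∪EI-CEH D , inj₁ ∘ H′⊆DCH D ] ,
  [ DCH⊆EI-NH∪H′ D , [ inj₁ ∘ EI-mono (CH⊆NH D) , inj₁ ∘ EI-mono (CEH⊆NH D) ] ]
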